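{- Let $k,m,r$ be positive integers with $r\le k-2$ and $k\le m$. Let $\mathcal S$ be the set of supports of the codewords of a binary constant weight code of length $m$, weight $k-2$ and minimum Hamming distance $4$ with $\alpha$ codewords (so $\alpha\le A(m,4,k-2)$). Let $\mathcal B_0$ be the multiset of $\left\lfloor\frac{k-1}{r}\right\rfloor{m\choose k-1}$ subsets of $[m]$ consisting of $\left\lfloor\frac{k-1}{r}\right\rfloor$ copies of each $(k-1)$-subset of $[m]$. Form $\mathcal B$ from $\mathcal B_0$ by, for each $S\in\mathcal S$, adding $S$ and removing one copy of each of the $m-k+2$ subsets of $[m]$ of size $k-1$ containing $S$. Write $\mathcal B=\{B_1,\dots,B_n\}$ and for $j\in[m]$ let $C_j=\{i\in[n]: j\in B_i\}$. Then $\{C_1,\dots,C_m\}$ is an $(n,N,k,m;r)$-MCBC with $$n=\left\lfloor\frac{k-1}{r}\right\rfloor{m\choose k-1}-\alpha(m-k+1)\quad\text{and}\quad N=n(k-1)-\alpha.$$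
   Context: An $(n,N,k,m;r)$ multiset combinatorial batch code (MCBC) is a collection $\mathcal C=\{C_1,\dots,C_m\}$ of subsets of $[n]=\{1,\dots,n\}$ (servers) with $N=\sum_{j=1}^m|C_j|$, such that for every multiset request $\{i_1,\dots,i_k\}$ of $k$ elements of $[n]$ in which every element has multiplicity at most $r$, there exist subsets $D_j\subseteq C_j$ with $|D_j|\le 1$ ($j\in[m]$) whose multiset union (the multiplicity of $i$ being $|\{j: i\in D_j\}|$) contains the request. $A(m,d,w)$ denotes the maximum number of codewords of a binary constant weight code of length $m$, weight $w$ and minimum Hamming distance $d$. -}

module Defs where

open import Data.Bool using (Bool; true; false; if_then_else_; _xor_)
import Data.Bool.Properties as BoolP
open import Data.Nat using (ℕ; zero; suc; _+_; _*_; _∸_; _≤_; NonZero)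
open import Data.Nat.DivMod using (_/_)
open import Data.Fin using (Fin)
open import Data.Fin.Properties using (_≟_)
open import Data.Fin.Subset using (Subset; inside; outside; _∈_; _⊆_; ∣_∣; _∪_; ⁅_⁆)
open import Data.Fin.Subset.Properties using (_∈?_)
open import Data.List as List using (List; []; _∷_; _++_; length; filter; replicate; concatMap; allFin)
open import Data.Vec as Vec using (Vec; []; _∷_; tabulate; count; zipWith)
import Data.Vec.Properties as VecP
open import Data.Product using (Σ; _×_; _,_)
open import Relation.Binary.PropositionalEquality using (_≡_; _≢_)
open import Relation.Nullary using (does)

hamming : ∀ {m} → Vec Bool m → Vec Bool m → ℕ
hamming x y = ∣ zipWith _xor_ x y ∣

-- A list of codewords forms a binary constant weight code of length m,
-- weight w and minimum distance d: every codeword has weight w and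
-- codewords at distinct positions have Hamming distance ≥ d.
-- (For d ≥ 1 this forces the codewords to be distinct, so the list
-- is a set and its length is the number of codewords α.)
IsCWCode : (m d w : ℕ) → List (Subset m) → Set
IsCWCode m d w 𝒮 =
  ((i : Fin (length 𝒮)) → ∣ List.lookup 𝒮 i ∣ ≡ w) ×
  ((i j : Fin (length 𝒮)) → i ≢ j → d ≤ hamming (List.lookup 𝒮 i) (List.lookup 𝒮 j))

total : ∀ {n m} → (Fin m → Subset n) → ℕ
total C = Vec.sum (tabulate (λ j → ∣ C j ∣))

-- multiplicity of i in a multiset request given as a vector of k elements
mult : ∀ {n k} → Fin n → Vec (Fin n) k → ℕ
mult i req = count (i ≟_) req

unionMult : ∀ {n m} → (Fin m → Subset n) → Fin n → ℕ
unionMult D i = ∣ tabulate (λ j → does (i ∈? D j)) ∣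

IsMCBC : (n N k m r : ℕ) → (Fin m → Subset n) → Set
IsMCBC n N k m r C =
  N ≡ total C ×
  ((req : Vec (Fin n) k) → ((i : Fin n) → mult i req ≤ r) →
    Σ (Fin m → Subset n) λ D →
      ((j : Fin m) → D j ⊆ C j × ∣ D j ∣ ≤ 1) ×
      ((i : Fin n) → mult i req ≤ unionMult D i))

allSubsets : ∀ n → List (Subset n)
allSubsets zero = [] ∷ []
allSubsets (suc n) = List.map (outside ∷_) (allSubsets n) ++ List.map (inside ∷_) (allSubsets n)

subsetsOfSize : ∀ m → ℕ → List (Subset m)
subsetsOfSize m s = filter (λ T → ∣ T ∣ Data.Nat.≟ s) (allSubsets m)

removeOne : ∀ {m} → Subset m → List (Subset m) → List (Subset m)
removeOne x [] = []
removeOne x (y ∷ ys) = if does (VecP.≡-dec BoolP._≟_ x y) then ys else y ∷ removeOne x ys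

B₀ : (k m r : ℕ) → .{{NonZero r}} → List (Subset m)
B₀ k m r = concatMap (λ T → replicate ((k ∸ 1) / r) T) (subsetsOfSize m (k ∸ 1))

modifyBy : ∀ {m} → Subset m → List (Subset m) → List (Subset m)
modifyBy {m} S B =
  S ∷ List.foldr (λ j acc → if does (j ∈? S) then acc else removeOne (S ∪ ⁅ j ⁆) acc) B (allFin m)

construction : (k m r : ℕ) → .{{NonZero r}} → List (Subset m) → List (Subset m)
construction k m r 𝒮 = List.foldr modifyBy (B₀ k m r) 𝒮

incidence : ∀ {m} → (B : List (Subset m)) → Fin m → Subset (length B)
incidence B j = tabulate (λ i → Vec.lookup (List.lookup B i) j)

-- Write k = s + 2 and q = ⌊(s+1)/r⌋.  Codewords are at distance ≥ 4, so
-- a set of size ≤ s + 1 contains at most one codeword ('apart').  Hence every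
-- extension is still present when it is removed, and as multisets
--     construction ++ (all extensions) ↭ codewords ++ B₀          ('balance').
-- Weighing this identity with w = 1, w = |·| and w = [· ⊆ U] gives the number n
-- of blocks, the number N of incidences (N = Σ_j |C_j| = Σ_i |B_i| by double
-- counting) and the bound  r · #{i : B_i ⊆ U} ≤ |U|  for |U| ≤ s + 1.  This bound
-- and the multiplicity bound r of a request give Hall's condition for every
-- request, and Hall's theorem for multisets (proved below by the classical
-- induction over critical sub-multisets) yields pairwise distinct servers, i.e.
-- the sets D_j of an MCBC.
module Submission where

open import Defs
open import Data.Bool using (Bool; true; false; not; if_then_else_)
open import Data.Bool.Properties using (if-float) renaming (_≟_ to _≟ᵇ_)
open import Data.Nat using (ℕ; zero; suc; _+_; _*_; _∸_; _≤_; _<_; _≤?_; z≤n; s≤s; NonZero; >-nonZero⁻¹)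
  renaming (_≟_ to _≟ℕ_)
open import Data.Nat.DivMod using (_/_; m/n*n≤m; m≥n⇒m/n>0)
open import Data.Nat.Combinatorics using (_C_; nCn≡1; k>n⇒nCk≡0; nCk+nC[k+1]≡[n+1]C[k+1])
open import Data.Nat.ListAction using () renaming (sum to listSum)
open import Data.Nat.ListAction.Properties using (sum-++; sum-↭)
open import Data.Nat.Properties hiding (_≟_; suc-injective)
open import Algebra.Properties.CommutativeSemigroup +-commutativeSemigroup
  using () renaming (x∙yz≈y∙xz to +-left-comm)
open import Algebra.Properties.Semiring.Sum +-*-semiring
  using (sum-syntax; ∑-comm; ∑-distrib-+; sum-cong-≗; sum-replicate-zero; *-distribˡ-sum)
open import Data.Fin using (Fin; zero; suc)
open import Data.Fin.Properties using (_≟_; suc-injective)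
open import Data.Fin.Subset using (Subset; inside; outside; _∈_; _∉_; _⊆_; ∣_∣; ⊥; ⊤; ∁; ⁅_⁆; _∪_; _─_; ⋃)
open import Data.Fin.Subset.Properties
  using (_∈?_; nonempty?; Empty-unique; ∣⊥∣≡0; p⊆p∪q; q⊆p∪q; ∣p∣≤∣p∪q∣; ∣q∣≤∣p∪q∣; p─q⊆p;
         ∪-assoc; ∪-identityˡ; ∪-identityʳ; ∪-isCommutativeMonoid; anySubset?; x∈⁅x⁆; ∣⁅x⁆∣≡1; ∉⊥; x∈⁅y⁆⇒x≡y; x∈p∪q⁻; p⊆q⇒∣p∣≤∣q∣;
         _⊆?_; ⊆⊤; ∣⊤∣≡n; ∣∁p∣≡n∸∣p∣)
open import Data.List as List using (List; []; _∷_; _++_; length; filter; replicate; concatMap; allFin)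
import Data.List.Properties as List
open import Data.List.Relation.Unary.All as All using (All; []; _∷_)
import Data.List.Relation.Unary.All.Properties as All
open import Data.List.Relation.Unary.AllPairs using (AllPairs; []; _∷_)
open import Data.List.Relation.Unary.Unique.Propositional using (Unique)
import Data.List.Relation.Unary.Unique.Propositional.Properties as Unique
open import Data.List.Relation.Unary.Unique.Propositional.Properties using (allFin⁺)
open import Data.List.Membership.Propositional using () renaming (_∈_ to _∈ₗ_)
open import Data.List.Membership.Propositional.Properties
  using (∈-map⁺; ∈-map⁻; ∈-++⁻; ∈-∃++; ∈-filter⁺; ∈-filter⁻; ∈-allFin; ∈-concat⁺′; ∈-++⁺ˡ; ∈-++⁺ʳ)
open import Data.List.Relation.Unary.Any using (here; there; index)
open import Data.List.Relation.Unary.Any.Properties using (lookup-index)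
open import Data.List.Relation.Binary.Permutation.Propositional
  using (_↭_; ↭-refl; ↭-sym; ↭-trans; ↭-prep; ↭-swap; ↭-reflexive; ↭⇒↭ₛ; module PermutationReasoning)
open import Data.List.Relation.Binary.Permutation.Propositional.Properties
  using (map⁺; ↭-length; ++⁺; ++⁺ʳ; ++⁺ˡ; shift; shifts; drop-∷; ∈-resp-↭; ↭-empty-inv)
  renaming (++-assoc to ↭-++-assoc)
import Data.List.Relation.Binary.Permutation.Setoid.Properties as PermSetoid
open import Data.Vec as Vec using (Vec; []; _∷_; tabulate; here; there)
open import Data.Vec.Properties using ([]=⇒lookup; lookup⇒[]=; lookup∘tabulate; lookup-map; ≡-dec; length-toList)
open import Data.Product using (Σ; _×_; _,_; proj₁; proj₂)
open import Data.Sum using (inj₁; inj₂; [_,_]′)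
open import Data.Empty using (⊥-elim)
open import Level using (0ℓ)
open import Relation.Nullary using (yes; no; ¬_; ¬?; does; contradiction)
open import Relation.Nullary.Decidable using (_×-dec_; dec-true)
open import Relation.Unary using (Pred; Decidable)
open import Relation.Binary.PropositionalEquality hiding ([_])
open import Data.Nat.Tactic.RingSolver using (solve-∀)
open import Function using (_∘_; const)

private
  variable
    A B : Set

⟦_⟧ : Bool → ℕ
⟦ true ⟧ = 1
⟦ false ⟧ = 0

Σ⟨_⟩ : {A : Set} → (A → ℕ) → List A → ℕ
Σ⟨ w ⟩ xs = listSum (List.map w xs)

Σ-↭ : ∀ (w : A → ℕ) {xs ys} → xs ↭ ys → Σ⟨ w ⟩ xs ≡ Σ⟨ w ⟩ ys
Σ-↭ w xs↭ys = sum-↭ (map⁺ w xs↭ys)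

Σ-++ : ∀ (w : A → ℕ) xs ys → Σ⟨ w ⟩ (xs ++ ys) ≡ Σ⟨ w ⟩ xs + Σ⟨ w ⟩ ys
Σ-++ w xs ys = trans (cong listSum (List.map-++ w xs ys)) (sum-++ (List.map w xs) _)

Σ-map : ∀ (w : B → ℕ) (f : A → B) xs → Σ⟨ w ⟩ (List.map f xs) ≡ Σ⟨ (λ x → w (f x)) ⟩ xs
Σ-map w f xs = cong listSum (sym (List.map-∘ xs))

Σ-concatMap : ∀ (w : B → ℕ) (f : A → List B) xs →
  Σ⟨ w ⟩ (concatMap f xs) ≡ Σ⟨ (λ x → Σ⟨ w ⟩ (f x)) ⟩ xs
Σ-concatMap w f [] = refl
Σ-concatMap w f (x ∷ xs) = trans (Σ-++ w (f x) (concatMap f xs)) (cong (Σ⟨ w ⟩ (f x) +_) (Σ-concatMap w f xs))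

Σ-replicate : ∀ (w : A → ℕ) q x → Σ⟨ w ⟩ (replicate q x) ≡ q * w x
Σ-replicate w zero x = refl
Σ-replicate w (suc q) x = cong (w x +_) (Σ-replicate w q x)

Σ-scale : ∀ c (w : A → ℕ) xs → Σ⟨ (λ x → c * w x) ⟩ xs ≡ c * Σ⟨ w ⟩ xs
Σ-scale c w [] = sym (*-zeroʳ c)
Σ-scale c w (x ∷ xs) = trans (cong (c * w x +_) (Σ-scale c w xs)) (sym (*-distribˡ-+ c (w x) _))

Σ-filter : ∀ {P : Pred A 0ℓ} (P? : Decidable P) (w : A → ℕ) xs →
  Σ⟨ w ⟩ (filter P? xs) ≡ Σ⟨ (λ x → if does (P? x) then w x else 0) ⟩ xs
Σ-filter P? w [] = refl
Σ-filter P? w (x ∷ xs) with does (P? x)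
... | true = cong (w x +_) (Σ-filter P? w xs)
... | false = Σ-filter P? w xs

Σ-const-on : ∀ (w : A → ℕ) c {xs} → All (λ x → w x ≡ c) xs → Σ⟨ w ⟩ xs ≡ length xs * c
Σ-const-on w c [] = refl
Σ-const-on w c (wx≡c ∷ rest) = cong₂ _+_ wx≡c (Σ-const-on w c rest)

Σ-mono : ∀ (v w : A → ℕ) {xs} → All (λ x → v x ≤ w x) xs → Σ⟨ v ⟩ xs ≤ Σ⟨ w ⟩ xs
Σ-mono v w [] = z≤n
Σ-mono v w (vx≤wx ∷ rest) = +-mono-≤ vx≤wx (Σ-mono v w rest)

Σ-∈ : ∀ (w : A → ℕ) {x xs} → x ∈ₗ xs → w x ≤ Σ⟨ w ⟩ xs
Σ-∈ w (here refl) = m≤m+n _ _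
Σ-∈ w {xs = y ∷ _} (there x∈xs) = ≤-trans (Σ-∈ w x∈xs) (m≤n+m _ (w y))

Σ-lookup : ∀ (w : A → ℕ) xs → ∑[ i < length xs ] w (List.lookup xs i) ≡ Σ⟨ w ⟩ xs
Σ-lookup w [] = refl
Σ-lookup w (x ∷ xs) = cong (w x +_) (Σ-lookup w xs)

Σ-cong : ∀ {v w : A → ℕ} → (∀ x → v x ≡ w x) → ∀ xs → Σ⟨ v ⟩ xs ≡ Σ⟨ w ⟩ xs
Σ-cong v≗w xs = cong listSum (List.map-cong v≗w xs)

Σ-one : ∀ (xs : List A) → Σ⟨ (λ _ → 1) ⟩ xs ≡ length xs
Σ-one [] = refl
Σ-one (x ∷ xs) = cong suc (Σ-one xs)

Σ-zero : ∀ (xs : List A) → Σ⟨ (λ _ → 0) ⟩ xs ≡ 0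
Σ-zero [] = refl
Σ-zero (x ∷ xs) = Σ-zero xs

Vec-sum-tabulate : ∀ {m} (f : Fin m → ℕ) → Vec.sum (tabulate f) ≡ ∑[ j < m ] f j
Vec-sum-tabulate {zero} f = refl
Vec-sum-tabulate {suc m} f = cong (f zero +_) (Vec-sum-tabulate (λ j → f (suc j)))

Σ-allFin : ∀ {m} (w : Fin m → ℕ) → Σ⟨ w ⟩ (allFin m) ≡ ∑[ j < m ] w j
Σ-allFin w = trans (cong listSum (List.map-tabulate (λ j → j) w)) (tabulate-sum w)
  where
  tabulate-sum : ∀ {m} (w : Fin m → ℕ) → listSum (List.tabulate w) ≡ ∑[ j < m ] w j
  tabulate-sum {zero} w = refl
  tabulate-sum {suc m} w = cong (w zero +_) (tabulate-sum (λ j → w (suc j)))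

∑-update : ∀ {m} (h : Fin m → ℕ) (x : Fin m) a → h x ≡ 0 →
  ∑[ j < m ] (if does (j ≟ x) then a else h j) ≡ a + ∑[ j < m ] h j
∑-update {suc m} h zero a h0≡0 = cong (λ t → a + (t + ∑[ j < m ] h (suc j))) (sym h0≡0)
∑-update {suc m} h (suc x) a hx≡0 =
  trans (cong (h zero +_) (∑-update (λ j → h (suc j)) x a hx≡0)) (+-left-comm (h zero) a _)

∣∷∣ : ∀ {n} b (p : Subset n) → ∣ b ∷ p ∣ ≡ ⟦ b ⟧ + ∣ p ∣
∣∷∣ true p = refl
∣∷∣ false p = refl

∣tabulate∣ : ∀ {n} (f : Fin n → Bool) → ∣ tabulate f ∣ ≡ ∑[ j < n ] ⟦ f j ⟧
∣tabulate∣ {zero} f = refl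
∣tabulate∣ {suc n} f = trans (∣∷∣ (f zero) (tabulate (λ j → f (suc j)))) (cong (⟦ f zero ⟧ +_) (∣tabulate∣ (λ j → f (suc j))))

∣p∣≡∑ : ∀ {n} (p : Subset n) → ∣ p ∣ ≡ ∑[ j < n ] ⟦ Vec.lookup p j ⟧
∣p∣≡∑ [] = refl
∣p∣≡∑ (b ∷ p) = trans (∣∷∣ b p) (cong (⟦ b ⟧ +_) (∣p∣≡∑ p))

does-∈? : ∀ {n} (j : Fin n) (p : Subset n) → does (j ∈? p) ≡ Vec.lookup p j
does-∈? zero (true ∷ p) = refl
does-∈? zero (false ∷ p) = refl
does-∈? (suc j) (b ∷ p) = does-∈? j p

∑-mono : ∀ {n} (f g : Fin n → ℕ) → (∀ i → f i ≤ g i) → ∑[ i < n ] f i ≤ ∑[ i < n ] g i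
∑-mono {zero} f g f≤g = z≤n
∑-mono {suc n} f g f≤g = +-mono-≤ (f≤g zero) (∑-mono (λ i → f (suc i)) (λ i → g (suc i)) (λ i → f≤g (suc i)))

δ : ∀ {n} → Fin n → Fin n → ℕ
δ i x = ⟦ does (i ≟ x) ⟧

occ : ∀ {n} → Fin n → List (Fin n) → ℕ
occ i = Σ⟨ δ i ⟩

mult≡occ : ∀ {n k} (i : Fin n) (req : Vec (Fin n) k) → mult i req ≡ occ i (Vec.toList req)
mult≡occ i [] = refl
mult≡occ i (x ∷ req) with does (i ≟ x)
... | true = cong suc (mult≡occ i req)
... | false = mult≡occ i req

occ-absent : ∀ {n} (i : Fin n) {X} → All (λ x → i ≢ x) X → occ i X ≡ 0
occ-absent i [] = refl
occ-absent i {x ∷ X} (i≢x ∷ rest) with i ≟ x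
... | yes i≡x = contradiction i≡x i≢x
... | no _ = occ-absent i rest

∑δ≡1 : ∀ {n} (x : Fin n) → ∑[ i < n ] δ i x ≡ 1
∑δ≡1 {suc n} zero = cong suc (sum-replicate-zero n)
∑δ≡1 {suc n} (suc x) = ∑δ≡1 x

length≡∑occ : ∀ {n} (X : List (Fin n)) → length X ≡ ∑[ i < n ] occ i X
length≡∑occ {n} [] = sym (sum-replicate-zero n)
length≡∑occ {n} (x ∷ X) = begin
  suc (length X)                                   ≡⟨ cong₂ _+_ (sym (∑δ≡1 x)) (length≡∑occ X) ⟩
  ∑[ i < n ] δ i x + ∑[ i < n ] occ i X            ≡⟨ ∑-distrib-+ (λ i → δ i x) (λ i → occ i X) ⟨
  ∑[ i < n ] occ i (x ∷ X)                          ∎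
  where open ≡-Reasoning

occupancy : ∀ {n} r (P : Fin n → Bool) (X : List (Fin n)) → All (λ x → P x ≡ true) X →
  (∀ i → occ i X ≤ r) → length X ≤ r * ∑[ i < n ] ⟦ P i ⟧
occupancy {n} r P X X⊆P occ≤r = begin
  length X                       ≡⟨ length≡∑occ X ⟩
  ∑[ i < n ] occ i X             ≤⟨ ∑-mono _ _ bound ⟩
  ∑[ i < n ] (r * ⟦ P i ⟧)       ≡⟨ *-distribˡ-sum r (λ i → ⟦ P i ⟧) ⟨
  r * ∑[ i < n ] ⟦ P i ⟧         ∎
  where
  open ≤-Reasoning
  bound : ∀ i → occ i X ≤ r * ⟦ P i ⟧
  bound i with P i in Pi
  ... | true = ≤-trans (occ≤r i) (≤-reflexive (sym (*-identityʳ r)))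
  ... | false = ≤-reflexive (trans (occ-absent i (All.map i-differs X⊆P)) (sym (*-zeroʳ r)))
    where
    i-differs : ∀ {x} → P x ≡ true → i ≢ x
    i-differs Px refl with () ← trans (sym Px) Pi

∈-of-nonempty : ∀ {n} (p : Subset n) → 1 ≤ ∣ p ∣ → Σ (Fin n) (_∈ p)
∈-of-nonempty {n} p 1≤∣p∣ with nonempty? p
... | yes x∈p = x∈p
... | no p-empty with refl ← Empty-unique p-empty = contradiction (≤-trans 1≤∣p∣ (≤-reflexive (∣⊥∣≡0 n))) λ ()

∣p∪q∣≡∣p─q∣+∣q∣ : ∀ {n} (p q : Subset n) → ∣ p ∪ q ∣ ≡ ∣ p ─ q ∣ + ∣ q ∣
∣p∪q∣≡∣p─q∣+∣q∣ [] [] = refl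
∣p∪q∣≡∣p─q∣+∣q∣ (true ∷ p) (true ∷ q) = trans (cong suc (∣p∪q∣≡∣p─q∣+∣q∣ p q)) (sym (+-suc _ _))
∣p∪q∣≡∣p─q∣+∣q∣ (false ∷ p) (true ∷ q) = trans (cong suc (∣p∪q∣≡∣p─q∣+∣q∣ p q)) (sym (+-suc _ _))
∣p∪q∣≡∣p─q∣+∣q∣ (true ∷ p) (false ∷ q) = cong suc (∣p∪q∣≡∣p─q∣+∣q∣ p q)
∣p∪q∣≡∣p─q∣+∣q∣ (false ∷ p) (false ∷ q) = ∣p∪q∣≡∣p─q∣+∣q∣ p q

⊥─p≡⊥ : ∀ {n} (p : Subset n) → ⊥ ─ p ≡ ⊥
⊥─p≡⊥ [] = refl
⊥─p≡⊥ (true ∷ p) = cong (outside ∷_) (⊥─p≡⊥ p)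
⊥─p≡⊥ (false ∷ p) = cong (outside ∷_) (⊥─p≡⊥ p)

─-distribʳ-∪ : ∀ {n} (p q u : Subset n) → (p ─ u) ∪ (q ─ u) ≡ (p ∪ q) ─ u
─-distribʳ-∪ [] [] [] = refl
─-distribʳ-∪ (a ∷ p) (b ∷ q) (true ∷ u) = cong (outside ∷_) (─-distribʳ-∪ p q u)
─-distribʳ-∪ (a ∷ p) (b ∷ q) (false ∷ u) = cong (_ ∷_) (─-distribʳ-∪ p q u)

x∈p─q⇒x∉q : ∀ {n x} (p q : Subset n) → x ∈ p ─ q → x ∉ q
x∈p─q⇒x∉q (a ∷ p) (false ∷ q) here = λ ()
x∈p─q⇒x∉q (a ∷ p) (b ∷ q) (there x∈p─q) (there x∈q) = x∈p─q⇒x∉q p q x∈p─q x∈q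

∣p∪⁅x⁆∣≡1+∣p∣ : ∀ {n} (p : Subset n) {x} → x ∉ p → ∣ p ∪ ⁅ x ⁆ ∣ ≡ suc ∣ p ∣
∣p∪⁅x⁆∣≡1+∣p∣ (true ∷ p) {zero} x∉p = contradiction here x∉p
∣p∪⁅x⁆∣≡1+∣p∣ (false ∷ p) {zero} x∉p = cong (λ q → suc ∣ q ∣) (∪-identityʳ p)
∣p∪⁅x⁆∣≡1+∣p∣ (true ∷ p) {suc x} x∉p = cong suc (∣p∪⁅x⁆∣≡1+∣p∣ p (λ x∈p → x∉p (there x∈p)))
∣p∪⁅x⁆∣≡1+∣p∣ (false ∷ p) {suc x} x∉p = ∣p∪⁅x⁆∣≡1+∣p∣ p (λ x∈p → x∉p (there x∈p))

-- Each coordinate in S ∪ S′ contributes 2 to both sides, the others nothing.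
hamming-∪ : ∀ {n} (S S′ : Subset n) → hamming S S′ + (∣ S ∣ + ∣ S′ ∣) ≡ ∣ S ∪ S′ ∣ + ∣ S ∪ S′ ∣
hamming-∪ [] [] = refl
hamming-∪ (a ∷ S) (b ∷ S′) = coordinate a b
  where
  h = hamming S S′
  u = ∣ S ∪ S′ ∣
  e₀ : ∀ u → suc u + suc u ≡ 2 + (u + u)
  e₀ = solve-∀
  e₁ : ∀ h a b → h + (suc a + suc b) ≡ 2 + (h + (a + b))
  e₁ = solve-∀
  e₂ : ∀ h a b → suc h + (suc a + b) ≡ 2 + (h + (a + b))
  e₂ = solve-∀
  e₃ : ∀ h a b → suc h + (a + suc b) ≡ 2 + (h + (a + b))
  e₃ = solve-∀
  coordinate : ∀ a b → hamming (a ∷ S) (b ∷ S′) + (∣ a ∷ S ∣ + ∣ b ∷ S′ ∣) ≡ ∣ (a ∷ S) ∪ (b ∷ S′) ∣ + ∣ (a ∷ S) ∪ (b ∷ S′) ∣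
  coordinate true true = trans (e₁ h ∣ S ∣ ∣ S′ ∣) (trans (cong (2 +_) (hamming-∪ S S′)) (sym (e₀ u)))
  coordinate true false = trans (e₂ h ∣ S ∣ ∣ S′ ∣) (trans (cong (2 +_) (hamming-∪ S S′)) (sym (e₀ u)))
  coordinate false true = trans (e₃ h ∣ S ∣ ∣ S′ ∣) (trans (cong (2 +_) (hamming-∪ S S′)) (sym (e₀ u)))
  coordinate false false = hamming-∪ S S′

apart : ∀ {n s} {S S′ T : Subset n} → ∣ S ∣ ≡ s → ∣ S′ ∣ ≡ s → 4 ≤ hamming S S′ →
  S ⊆ T → S′ ⊆ T → 2 + s ≤ ∣ T ∣
apart {s = s} {S} {S′} {T} ∣S∣≡s ∣S′∣≡s 4≤d S⊆T S′⊆T = half (begin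
  (2 + s) + (2 + s)                   ≡⟨ e _ ⟩
  4 + (s + s)                         ≡⟨ cong₂ (λ a b → 4 + (a + b)) ∣S∣≡s ∣S′∣≡s ⟨
  4 + (∣ S ∣ + ∣ S′ ∣)                ≤⟨ +-monoˡ-≤ _ 4≤d ⟩
  hamming S S′ + (∣ S ∣ + ∣ S′ ∣)     ≡⟨ hamming-∪ S S′ ⟩
  ∣ S ∪ S′ ∣ + ∣ S ∪ S′ ∣             ≤⟨ +-mono-≤ ∣S∪S′∣≤∣T∣ ∣S∪S′∣≤∣T∣ ⟩
  ∣ T ∣ + ∣ T ∣                       ∎)
  where
  open ≤-Reasoning
  e : ∀ s → (2 + s) + (2 + s) ≡ 4 + (s + s)
  e = solve-∀
  ∣S∪S′∣≤∣T∣ : ∣ S ∪ S′ ∣ ≤ ∣ T ∣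
  ∣S∪S′∣≤∣T∣ = p⊆q⇒∣p∣≤∣q∣ (λ x∈ → [ S⊆T , S′⊆T ]′ (x∈p∪q⁻ S S′ x∈))
  half : ∀ {a b} → a + a ≤ b + b → a ≤ b
  half {a} {b} a+a≤b+b = ≮⇒≥ (λ b<a → <⇒≱ (+-mono-< b<a b<a) a+a≤b+b)

module Hall {m : ℕ} {I : Set} where

  N : (I → Subset m) → List I → Subset m
  N σ X = ⋃ (List.map σ X)

  N-++ : ∀ σ X Y → N σ (X ++ Y) ≡ N σ X ∪ N σ Y
  N-++ σ [] Y = sym (∪-identityˡ (N σ Y))
  N-++ σ (i ∷ X) Y = trans (cong (σ i ∪_) (N-++ σ X Y)) (sym (∪-assoc (σ i) (N σ X) (N σ Y)))

  N-↭ : ∀ σ {X Y} → X ↭ Y → N σ X ≡ N σ Y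
  N-↭ σ X↭Y = PermSetoid.foldr-commMonoid (setoid (Subset m)) (∪-isCommutativeMonoid m) (↭⇒↭ₛ (map⁺ σ X↭Y))

  N-─ : ∀ σ u X → N (λ i → σ i ─ u) X ≡ N σ X ─ u
  N-─ σ u [] = sym (⊥─p≡⊥ u)
  N-─ σ u (i ∷ X) = trans (cong ((σ i ─ u) ∪_) (N-─ σ u X)) (─-distribʳ-∪ (σ i) (N σ X) u)

  ∈-N : ∀ σ {i X x} → i ∈ₗ X → x ∈ σ i → x ∈ N σ X
  ∈-N σ {i} (here refl) x∈σi = p⊆p∪q {p = σ i} _ x∈σi
  ∈-N σ {X = j ∷ X} (there i∈X) x∈σi = q⊆p∪q (σ j) (N σ X) (∈-N σ i∈X x∈σi)

  -- Hall's condition for the multiset L: every sub-multiset X has at least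
  -- |X| neighbours.  Sub-multisets are described as splittings L ↭ X ++ Y.
  HallCondition : (I → Subset m) → List I → Set
  HallCondition σ L = ∀ X Y → L ↭ X ++ Y → length X ≤ ∣ N σ X ∣

  record Matching (σ : I → Subset m) (L : List I) : Set where
    field
      pairs    : List (I × Fin m)
      covers   : List.map proj₁ pairs ↭ L
      fits     : All (λ p → proj₂ p ∈ σ (proj₁ p)) pairs
      distinct : Unique (List.map proj₂ pairs)

  open Matching

  -- Sub-multisets of L, enumerated by characteristic vectors over the entries of L.
  chosen unchosen : (L : List I) → Subset (length L) → List I
  chosen [] [] = []
  chosen (i ∷ L) (inside ∷ c) = i ∷ chosen L c
  chosen (i ∷ L) (outside ∷ c) = chosen L c
  unchosen [] [] = []
  unchosen (i ∷ L) (inside ∷ c) = unchosen L c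
  unchosen (i ∷ L) (outside ∷ c) = i ∷ unchosen L c

  chosen-split : ∀ L c → L ↭ chosen L c ++ unchosen L c
  chosen-split [] [] = ↭-refl
  chosen-split (i ∷ L) (inside ∷ c) = ↭-prep i (chosen-split L c)
  chosen-split (i ∷ L) (outside ∷ c) =
    ↭-trans (↭-prep i (chosen-split L c)) (↭-sym (shift i (chosen L c) (unchosen L c)))

  chosen-complete : ∀ L X Y → L ↭ X ++ Y → Σ (Subset (length L)) λ c → chosen L c ↭ X
  chosen-complete [] [] Y _ = [] , ↭-refl
  chosen-complete [] (x ∷ X) Y []↭XY with () ← ↭-empty-inv (↭-sym []↭XY)
  chosen-complete (i ∷ L) X Y L↭XY with ∈-++⁻ X (∈-resp-↭ L↭XY (here refl))
  ... | inj₁ i∈X with ∈-∃++ i∈X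
  ...   | us , vs , refl with chosen-complete L (us ++ vs) Y
          (drop-∷ (↭-trans L↭XY (++⁺ʳ Y (shift i us vs))))
  ...     | c , chosen↭ = inside ∷ c , ↭-trans (↭-prep i chosen↭) (↭-sym (shift i us vs))
  chosen-complete (i ∷ L) X Y L↭XY | inj₂ i∈Y with ∈-∃++ i∈Y
  ...   | us , vs , refl with chosen-complete L X (us ++ vs)
          (drop-∷ (↭-trans L↭XY (↭-trans (++⁺ˡ X (shift i us vs)) (shift i X (us ++ vs)))))
  ...     | c , chosen↭ = outside ∷ c , chosen↭

  hall-restrict : ∀ σ {L X Y} → HallCondition σ L → L ↭ X ++ Y → HallCondition σ X
  hall-restrict σ {Y = Y} H L↭XY Z W X↭ZW =
    H Z (W ++ Y) (↭-trans L↭XY (↭-trans (++⁺ʳ Y X↭ZW) (↭-++-assoc Z W Y)))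

  hall-shrink : ∀ σ u {Y} → (∀ Z W → Y ↭ Z ++ W → length Z + ∣ u ∣ ≤ ∣ N σ Z ∪ u ∣) →
    HallCondition (λ i → σ i ─ u) Y
  hall-shrink σ u slack Z W Y↭ZW = +-cancelʳ-≤ ∣ u ∣ (length Z) _ (begin
    length Z + ∣ u ∣                   ≤⟨ slack Z W Y↭ZW ⟩
    ∣ N σ Z ∪ u ∣                      ≡⟨ ∣p∪q∣≡∣p─q∣+∣q∣ (N σ Z) u ⟩
    ∣ N σ Z ─ u ∣ + ∣ u ∣              ≡⟨ cong (λ v → ∣ v ∣ + ∣ u ∣) (N-─ σ u Z) ⟨
    ∣ N (λ i → σ i ─ u) Z ∣ + ∣ u ∣    ∎)
    where open ≤-Reasoning

  matching-↭ : ∀ {σ L L′} → L ↭ L′ → Matching σ L → Matching σ L′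
  matching-↭ L↭L′ M = record
    { pairs = pairs M ; covers = ↭-trans (covers M) L↭L′ ; fits = fits M ; distinct = distinct M }

  matched-in-N : ∀ σ {X} (M : Matching σ X) → All (λ p → proj₂ p ∈ N σ X) (pairs M)
  matched-in-N σ M = All.tabulate λ p∈ →
    ∈-N σ (∈-resp-↭ (covers M) (∈-map⁺ proj₁ p∈)) (All.lookup (fits M) p∈)

  merge : ∀ σ u {X Y} (M : Matching σ X) → All (λ p → proj₂ p ∈ u) (pairs M) →
    Matching (λ i → σ i ─ u) Y → Matching σ (X ++ Y)
  merge σ u M M-in-u M′ = record
    { pairs    = pairs M ++ pairs M′
    ; covers   = subst (_↭ _) (sym (List.map-++ proj₁ (pairs M) (pairs M′))) (++⁺ (covers M) (covers M′))
    ; fits     = All.++⁺ (fits M) (All.map (λ {p} → p─q⊆p (σ (proj₁ p)) u) (fits M′))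
    ; distinct = subst Unique (sym (List.map-++ proj₂ (pairs M) (pairs M′)))
                   (Unique.++⁺ (distinct M) (distinct M′) disjoint)
    }
    where
    in-u : All (_∈ u) (List.map proj₂ (pairs M))
    in-u = All.map⁺ M-in-u
    outside-u : All (_∉ u) (List.map proj₂ (pairs M′))
    outside-u = All.map⁺ (All.map (λ {p} → x∈p─q⇒x∉q (σ (proj₁ p)) u) (fits M′))
    disjoint : ∀ {x} → ¬ (x ∈ₗ List.map proj₂ (pairs M) × x ∈ₗ List.map proj₂ (pairs M′))
    disjoint (x∈M , x∈M′) = All.lookup outside-u x∈M′ (All.lookup in-u x∈M)

  Critical : (I → Subset m) → List I → Set
  Critical σ X = 1 ≤ length X × ∣ N σ X ∣ ≤ length X

  Solves : ℕ → Set
  Solves f = ∀ σ L → length L ≤ f → HallCondition σ L → Matching σ L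

  length-chosen : ∀ L c → length (chosen L c) + length (unchosen L c) ≡ length L
  length-chosen L c = trans (sym (List.length-++ (chosen L c))) (sym (↭-length (chosen-split L c)))

  -- If the tail L contains a critical sub-multiset X, match X inside N(X) and
  -- A together with the rest of L outside N(X); both are smaller instances.
  step-critical : ∀ {f} → Solves f → ∀ σ A L → length L ≤ f → HallCondition σ (A ∷ L) →
    ∀ c → Critical σ (chosen L c) → Matching σ (A ∷ L)
  step-critical rec σ A L |L|≤f H c (1≤|X| , |NX|≤|X|) =
    matching-↭ (↭-sym A∷L↭) (merge σ (N σ X) Mx (matched-in-N σ Mx) My)
    where
    X = chosen L c
    Y = unchosen L c
    A∷L↭ : A ∷ L ↭ X ++ A ∷ Y
    A∷L↭ = ↭-trans (↭-prep A (chosen-split L c)) (↭-sym (shift A X Y))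
    slack : ∀ Z W → A ∷ Y ↭ Z ++ W → length Z + ∣ N σ X ∣ ≤ ∣ N σ Z ∪ N σ X ∣
    slack Z W A∷Y↭ZW = begin
      length Z + ∣ N σ X ∣   ≤⟨ +-monoʳ-≤ (length Z) |NX|≤|X| ⟩
      length Z + length X    ≡⟨ List.length-++ Z ⟨
      length (Z ++ X)        ≤⟨ H (Z ++ X) W A∷L↭ZXW ⟩
      ∣ N σ (Z ++ X) ∣       ≡⟨ cong ∣_∣ (N-++ σ Z X) ⟩
      ∣ N σ Z ∪ N σ X ∣      ∎
      where
      open ≤-Reasoning
      A∷L↭ZXW : A ∷ L ↭ (Z ++ X) ++ W
      A∷L↭ZXW = ↭-trans A∷L↭ (↭-trans (++⁺ˡ X A∷Y↭ZW) (↭-trans (shifts X Z) (↭-sym (↭-++-assoc Z X W))))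
    Mx = rec σ X (≤-trans (m≤m+n _ _) (≤-trans (≤-reflexive (length-chosen L c)) |L|≤f))
                 (hall-restrict σ H A∷L↭)
    My = rec (λ i → σ i ─ N σ X) (A ∷ Y)
                 (≤-trans (+-monoˡ-≤ _ 1≤|X|) (≤-trans (≤-reflexive (length-chosen L c)) |L|≤f))
                 (hall-shrink σ (N σ X) slack)

  -- Otherwise every nonempty sub-multiset of L has a spare neighbour: match A
  -- to any x ∈ σ A and match L with x deleted from every set.
  step-free : ∀ {f} → Solves f → ∀ σ A L → length L ≤ f → HallCondition σ (A ∷ L) →
    (∀ c → ¬ Critical σ (chosen L c)) → Matching σ (A ∷ L)
  step-free rec σ A L |L|≤f H no-critical =
    merge σ ⁅ x ⁆ MA (x∈⁅x⁆ x ∷ []) (rec (λ i → σ i ─ ⁅ x ⁆) L |L|≤f (hall-shrink σ ⁅ x ⁆ slack))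
    where
    x∈σA : Σ (Fin m) (_∈ σ A)
    x∈σA = ∈-of-nonempty (σ A) (subst (λ p → 1 ≤ ∣ p ∣) (∪-identityʳ (σ A)) (H (A ∷ []) L ↭-refl))
    x = proj₁ x∈σA
    MA : Matching σ (A ∷ [])
    MA = record { pairs = (A , x) ∷ [] ; covers = ↭-refl ; fits = proj₂ x∈σA ∷ [] ; distinct = [] ∷ [] }
    slack : ∀ Z W → L ↭ Z ++ W → length Z + ∣ ⁅ x ⁆ ∣ ≤ ∣ N σ Z ∪ ⁅ x ⁆ ∣
    slack [] W _ = ∣q∣≤∣p∪q∣ ⊥ ⁅ x ⁆
    slack Z@(_ ∷ _) W L↭ZW with chosen-complete L Z W L↭ZW
    ... | c , chosen↭Z = begin
      length Z + ∣ ⁅ x ⁆ ∣            ≡⟨ cong (length Z +_) (∣⁅x⁆∣≡1 x) ⟩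
      length Z + 1                     ≡⟨ +-comm (length Z) 1 ⟩
      suc (length Z)                   ≤⟨ ≰⇒> (λ |NZ|≤|Z| → no-critical c (1≤|C| , |NC|≤|C| |NZ|≤|Z|)) ⟩
      ∣ N σ Z ∣                        ≤⟨ ∣p∣≤∣p∪q∣ (N σ Z) ⁅ x ⁆ ⟩
      ∣ N σ Z ∪ ⁅ x ⁆ ∣                ∎
      where
      open ≤-Reasoning
      |C|≡|Z| = ↭-length chosen↭Z
      1≤|C| : 1 ≤ length (chosen L c)
      1≤|C| = subst (1 ≤_) (sym |C|≡|Z|) (s≤s z≤n)
      |NC|≤|C| : ∣ N σ Z ∣ ≤ length Z → ∣ N σ (chosen L c) ∣ ≤ length (chosen L c)
      |NC|≤|C| = subst₂ _≤_ (cong ∣_∣ (sym (N-↭ σ chosen↭Z))) (sym |C|≡|Z|)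

  solve : ∀ f → Solves f
  solve f σ [] _ _ = record { pairs = [] ; covers = ↭-refl ; fits = [] ; distinct = [] }
  solve (suc f) σ (A ∷ L) (s≤s |L|≤f) H
    with anySubset? (λ c → (1 ≤? length (chosen L c)) ×-dec (∣ N σ (chosen L c) ∣ ≤? length (chosen L c)))
  ... | yes (c , critical) = step-critical (solve f) σ A L |L|≤f H c critical
  ... | no none = step-free (solve f) σ A L |L|≤f H (λ c critical → none (c , critical))

  hall : ∀ σ L → HallCondition σ L → Matching σ L
  hall σ L = solve (length L) σ L ≤-refl

open Hall

module Assignment {n m : ℕ} where

  assign : List (Fin n × Fin m) → Fin m → Subset n
  assign [] j = ⊥
  assign ((i , x) ∷ ps) j = if does (j ≟ x) then ⁅ i ⁆ else assign ps j

  assign-size : ∀ ps j → ∣ assign ps j ∣ ≤ 1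
  assign-size [] j = subst (_≤ 1) (sym (∣⊥∣≡0 n)) z≤n
  assign-size ((i , x) ∷ ps) j with does (j ≟ x)
  ... | true = ≤-reflexive (∣⁅x⁆∣≡1 i)
  ... | false = assign-size ps j

  assign-sound : ∀ ps {i j} → i ∈ assign ps j → (i , j) ∈ₗ ps
  assign-sound [] i∈⊥ = contradiction i∈⊥ ∉⊥
  assign-sound ((i′ , x) ∷ ps) {i} {j} i∈ with j ≟ x
  ... | yes refl = here (cong (_, j) (x∈⁅y⁆⇒x≡y i′ i∈))
  ... | no _ = there (assign-sound ps i∈)

  assign-unused : ∀ ps {x} → All (x ≢_) (List.map proj₂ ps) → assign ps x ≡ ⊥
  assign-unused [] [] = refl
  assign-unused ((i , y) ∷ ps) {x} (x≢y ∷ rest) with x ≟ y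
  ... | yes x≡y = contradiction x≡y x≢y
  ... | no _ = assign-unused ps rest

  δ≤∈⁅⁆ : ∀ (i i′ : Fin n) → δ i i′ ≤ ⟦ does (i ∈? ⁅ i′ ⁆) ⟧
  δ≤∈⁅⁆ i i′ with i ≟ i′ | i ∈? ⁅ i′ ⁆
  ... | yes refl | yes _ = ≤-refl
  ... | yes refl | no i∉⁅i⁆ = contradiction (x∈⁅x⁆ i) i∉⁅i⁆
  ... | no _ | _ = z≤n

  assign-count : ∀ ps → Unique (List.map proj₂ ps) → ∀ i →
    Σ⟨ (λ p → δ i (proj₁ p)) ⟩ ps ≤ ∑[ j < m ] ⟦ does (i ∈? assign ps j) ⟧
  assign-count [] _ i = z≤n
  assign-count ((i′ , x) ∷ ps) (x-new ∷ unique) i = begin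
    δ i i′ + Σ⟨ (λ p → δ i (proj₁ p)) ⟩ ps
      ≤⟨ +-mono-≤ (δ≤∈⁅⁆ i i′) (assign-count ps unique i) ⟩
    read ⁅ i′ ⁆ + ∑[ j < m ] read (assign ps j)
      ≡⟨ ∑-update (λ j → read (assign ps j)) x (read ⁅ i′ ⁆) unread ⟨
    ∑[ j < m ] (if does (j ≟ x) then read ⁅ i′ ⁆ else read (assign ps j))
      ≡⟨ sum-cong-≗ (λ j → if-float read (does (j ≟ x))) ⟨
    ∑[ j < m ] read (assign ((i′ , x) ∷ ps) j)
      ∎
    where
    open ≤-Reasoning
    read : Subset n → ℕ
    read p = ⟦ does (i ∈? p) ⟧
    unread : read (assign ps x) ≡ 0
    unread rewrite assign-unused ps x-new with i ∈? ⊥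
    ... | yes i∈⊥ = contradiction i∈⊥ ∉⊥
    ... | no _ = refl

open Assignment

∈-incidence : ∀ {m} (B : List (Subset m)) {i j} → j ∈ List.lookup B i → i ∈ incidence B j
∈-incidence B {i} {j} j∈Bi =
  lookup⇒[]= i (incidence B j) (trans (lookup∘tabulate _ i) ([]=⇒lookup j∈Bi))

retrieval : ∀ {m k} (B : List (Subset m)) (req : Vec (Fin (length B)) k) →
  HallCondition (List.lookup B) (Vec.toList req) →
  Σ (Fin m → Subset (length B)) λ D →
    ((j : Fin m) → D j ⊆ incidence B j × ∣ D j ∣ ≤ 1) ×
    ((i : Fin (length B)) → mult i req ≤ unionMult D i)
retrieval {m} B req H = assign ps , (λ j → D⊆C j , assign-size ps j) , served
  where
  M = hall (List.lookup B) (Vec.toList req) H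
  ps = Matching.pairs M
  D⊆C : ∀ j → assign ps j ⊆ incidence B j
  D⊆C j i∈Dj = ∈-incidence B (All.lookup (Matching.fits M) (assign-sound ps i∈Dj))
  served : ∀ i → mult i req ≤ unionMult (assign ps) i
  served i = begin
    mult i req                                 ≡⟨ mult≡occ i req ⟩
    occ i (Vec.toList req)                     ≡⟨ Σ-↭ (δ i) (↭-sym (Matching.covers M)) ⟩
    occ i (List.map proj₁ ps)                  ≡⟨ Σ-map (δ i) proj₁ ps ⟩
    Σ⟨ (λ p → δ i (proj₁ p)) ⟩ ps               ≤⟨ assign-count ps (Matching.distinct M) i ⟩
    ∑[ j < m ] ⟦ does (i ∈? assign ps j) ⟧     ≡⟨ ∣tabulate∣ (λ j → does (i ∈? assign ps j)) ⟨
    unionMult (assign ps) i                    ∎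
    where open ≤-Reasoning

total-incidence : ∀ {m} (B : List (Subset m)) → total (incidence B) ≡ Σ⟨ ∣_∣ ⟩ B
total-incidence {m} B = begin
  Vec.sum (tabulate (λ j → ∣ incidence B j ∣))    ≡⟨ Vec-sum-tabulate (λ j → ∣ incidence B j ∣) ⟩
  ∑[ j < m ] ∣ incidence B j ∣                     ≡⟨ sum-cong-≗ (λ j → ∣tabulate∣ (λ i → b i j)) ⟩
  ∑[ j < m ] ∑[ i < length B ] ⟦ b i j ⟧          ≡⟨ ∑-comm (λ j i → ⟦ b i j ⟧) ⟩
  ∑[ i < length B ] ∑[ j < m ] ⟦ b i j ⟧          ≡⟨ sum-cong-≗ (λ i → ∣p∣≡∑ (List.lookup B i)) ⟨
  ∑[ i < length B ] ∣ List.lookup B i ∣            ≡⟨ Σ-lookup ∣_∣ B ⟩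
  Σ⟨ ∣_∣ ⟩ B                                       ∎
  where
  open ≡-Reasoning
  b : Fin (length B) → Fin m → Bool
  b i j = Vec.lookup (List.lookup B i) j

removeOne-↭ : ∀ {m} {x : Subset m} {xs} → x ∈ₗ xs → xs ↭ x ∷ removeOne x xs
removeOne-↭ {x = x} {y ∷ ys} x∈ with ≡-dec _≟ᵇ_ x y
... | yes refl = ↭-refl
... | no x≢y with x∈
...   | here x≡y = contradiction x≡y x≢y
...   | there x∈ys = ↭-trans (↭-prep y (removeOne-↭ x∈ys)) (↭-swap y x ↭-refl)

extensions : ∀ {m} → Subset m → List (Fin m) → List (Subset m)
extensions S js = List.map (λ j → S ∪ ⁅ j ⁆) (filter (λ j → ¬? (j ∈? S)) js)

-- Removing one copy of each extension S ∪ {j}, j ∈ js ∖ S; for js = allFin m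
-- this is what modifyBy does besides adding S.
strip : ∀ {m} → Subset m → List (Subset m) → List (Fin m) → List (Subset m)
strip S B js = List.foldr (λ j acc → if does (j ∈? S) then acc else removeOne (S ∪ ⁅ j ⁆) acc) B js

extension-⊇ : ∀ {m} {S T : Subset m} js → T ∈ₗ extensions S js → S ⊆ T
extension-⊇ {S = S} js T∈ with ∈-map⁻ (λ j → S ∪ ⁅ j ⁆) T∈
... | j , _ , refl = p⊆p∪q {p = S} ⁅ j ⁆

∪⁅⁆-injective : ∀ {m} {S : Subset m} {j j′} → j ∉ S → S ∪ ⁅ j ⁆ ≡ S ∪ ⁅ j′ ⁆ → j ≡ j′
∪⁅⁆-injective {S = S} {j} {j′} j∉S eq with x∈p∪q⁻ S ⁅ j′ ⁆ (subst (j ∈_) eq (q⊆p∪q S ⁅ j ⁆ (x∈⁅x⁆ j)))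
... | inj₁ j∈S = contradiction j∈S j∉S
... | inj₂ j∈⁅j′⁆ = x∈⁅y⁆⇒x≡y j′ j∈⁅j′⁆

strip-↭ : ∀ {m} (S : Subset m) B js → Unique js → All (_∈ₗ B) (extensions S js) →
  strip S B js ++ extensions S js ↭ B
strip-↭ S B [] _ _ = ↭-reflexive (List.++-identityʳ B)
strip-↭ S B (j ∷ js) (j-new ∷ unique) present with j ∈? S
... | yes _ = strip-↭ S B js unique present
... | no j∉S with present
...   | T∈B ∷ rest = begin
        removeOne T R ++ T ∷ E     ↭⟨ shift T (removeOne T R) E ⟩
        T ∷ removeOne T R ++ E     ↭⟨ ++⁺ʳ E (removeOne-↭ T∈R) ⟨
        R ++ E                     ↭⟨ strip-↭ S B js unique rest ⟩
        B                          ∎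
  where
  open PermutationReasoning
  T = S ∪ ⁅ j ⁆
  R = strip S B js
  E = extensions S js
  T∉E : ¬ T ∈ₗ E
  T∉E T∈E with ∈-map⁻ (λ j → S ∪ ⁅ j ⁆) T∈E
  ... | j′ , j′∈ , T≡ = All.lookup j-new (proj₁ (∈-filter⁻ (λ j → ¬? (j ∈? S)) j′∈)) (∪⁅⁆-injective j∉S T≡)
  T∈R : T ∈ₗ R
  T∈R with ∈-++⁻ R (∈-resp-↭ (↭-sym (strip-↭ S B js unique rest)) T∈B)
  ... | inj₁ T∈R = T∈R
  ... | inj₂ T∈E = contradiction T∈E T∉E

allSubsets-complete : ∀ {m} (T : Subset m) → T ∈ₗ allSubsets m
allSubsets-complete [] = here refl
allSubsets-complete {suc m} (outside ∷ T) = ∈-++⁺ˡ (∈-map⁺ (outside ∷_) (allSubsets-complete T))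
allSubsets-complete {suc m} (inside ∷ T) =
  ∈-++⁺ʳ (List.map (outside ∷_) (allSubsets m)) (∈-map⁺ (inside ∷_) (allSubsets-complete T))

within : ∀ {m} → Subset m → Subset m → ℕ
within U T = ⟦ does (T ⊆? U) ⟧

within-yes : ∀ {m} {U T : Subset m} → T ⊆ U → within U T ≡ 1
within-yes {U = U} {T} T⊆U = cong ⟦_⟧ (dec-true (T ⊆? U) T⊆U)

within-no : ∀ {m} {U T : Subset m} → ¬ T ⊆ U → within U T ≡ 0
within-no {U = U} {T} T⊈U with T ⊆? U
... | yes T⊆U = ⊥-elim (T⊈U T⊆U)
... | no _ = refl

-- Among all subsets of [m], exactly C(|U|, s) have size s and lie within U
-- (Pascal's rule on the last coordinate).
count-inside : ∀ m (U : Subset m) s →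
  Σ⟨ (λ T → if does (∣ T ∣ ≟ℕ s) then within U T else 0) ⟩ (allSubsets m) ≡ ∣ U ∣ C s
count-inside zero [] zero = refl
count-inside zero [] (suc s) = refl
count-inside (suc m) (u ∷ U) s = begin
  Σ⟨ f ⟩ (List.map (outside ∷_) (allSubsets m) ++ List.map (inside ∷_) (allSubsets m))
    ≡⟨ Σ-++ f (List.map (outside ∷_) (allSubsets m)) (List.map (inside ∷_) (allSubsets m)) ⟩
  Σ⟨ f ⟩ (List.map (outside ∷_) (allSubsets m)) + Σ⟨ f ⟩ (List.map (inside ∷_) (allSubsets m))
    ≡⟨ cong₂ _+_ (Σ-map f (outside ∷_) (allSubsets m)) (Σ-map f (inside ∷_) (allSubsets m)) ⟩
  Σ⟨ (λ T → f (outside ∷ T)) ⟩ (allSubsets m) + Σ⟨ (λ T → f (inside ∷ T)) ⟩ (allSubsets m)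
    ≡⟨ cong (_+ Σ⟨ (λ T → f (inside ∷ T)) ⟩ (allSubsets m)) (count-inside m U s) ⟩
  ∣ U ∣ C s + Σ⟨ (λ T → f (inside ∷ T)) ⟩ (allSubsets m)
    ≡⟨ with-last u s ⟩
  ∣ u ∷ U ∣ C s ∎
  where
  open ≡-Reasoning
  if-0 : ∀ b → (if b then 0 else 0) ≡ 0
  if-0 true = refl
  if-0 false = refl
  f : Subset (suc m) → ℕ
  f T = if does (∣ T ∣ ≟ℕ s) then within (u ∷ U) T else 0
  -- Subsets containing the new coordinate: none lies within U unless the
  -- coordinate is in U, and then they are counted by C(|U|, s - 1).
  with-last : ∀ u s → ∣ U ∣ C s + Σ⟨ (λ T → if does (∣ inside ∷ T ∣ ≟ℕ s) then within (u ∷ U) (inside ∷ T) else 0) ⟩ (allSubsets m)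
                    ≡ ∣ u ∷ U ∣ C s
  with-last outside s = trans (cong (∣ U ∣ C s +_) (trans (Σ-cong (λ T → if-0 (does (suc ∣ T ∣ ≟ℕ s))) (allSubsets m))
                                                           (Σ-zero (allSubsets m))))
                              (+-identityʳ _)
  with-last inside zero = cong (∣ U ∣ C 0 +_) (Σ-zero (allSubsets m))
  with-last inside (suc s) = begin
    ∣ U ∣ C suc s + Σ⟨ g ⟩ (allSubsets m)   ≡⟨ cong (∣ U ∣ C suc s +_) (count-inside m U s) ⟩
    ∣ U ∣ C suc s + ∣ U ∣ C s               ≡⟨ +-comm (∣ U ∣ C suc s) _ ⟩
    ∣ U ∣ C s + ∣ U ∣ C suc s               ≡⟨ nCk+nC[k+1]≡[n+1]C[k+1] ∣ U ∣ s ⟩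
    suc ∣ U ∣ C suc s                       ∎
    where
    g : Subset m → ℕ
    g T = if does (∣ T ∣ ≟ℕ s) then within U T else 0

subsets-inside : ∀ m (U : Subset m) s → Σ⟨ within U ⟩ (subsetsOfSize m s) ≡ ∣ U ∣ C s
subsets-inside m U s = trans (Σ-filter (λ T → ∣ T ∣ ≟ℕ s) (within U) (allSubsets m)) (count-inside m U s)

length-subsetsOfSize : ∀ m s → length (subsetsOfSize m s) ≡ m C s
length-subsetsOfSize m s = begin
  length (subsetsOfSize m s)             ≡⟨ Σ-one (subsetsOfSize m s) ⟨
  Σ⟨ (λ _ → 1) ⟩ (subsetsOfSize m s)     ≡⟨ Σ-cong (λ T → sym (within-yes {U = ⊤} {T} ⊆⊤)) (subsetsOfSize m s) ⟩
  Σ⟨ within ⊤ ⟩ (subsetsOfSize m s)      ≡⟨ subsets-inside m ⊤ s ⟩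
  ∣ ⊤ {m} ∣ C s                          ≡⟨ cong (_C s) (∣⊤∣≡n m) ⟩
  m C s                                  ∎
  where open ≡-Reasoning

Σ-size-subsetsOfSize : ∀ m s → Σ⟨ ∣_∣ ⟩ (subsetsOfSize m s) ≡ (m C s) * s
Σ-size-subsetsOfSize m s = trans (Σ-const-on ∣_∣ s (All.all-filter (λ T → ∣ T ∣ ≟ℕ s) (allSubsets m)))
                                 (cong (_* s) (length-subsetsOfSize m s))

length-outside : ∀ {m} (S : Subset m) → length (filter (λ j → ¬? (j ∈? S)) (allFin m)) ≡ m ∸ ∣ S ∣
length-outside {m} S = begin
  length (filter P? (allFin m))                            ≡⟨ Σ-one (filter P? (allFin m)) ⟨
  Σ⟨ (λ _ → 1) ⟩ (filter P? (allFin m))                    ≡⟨ Σ-filter P? (λ _ → 1) (allFin m) ⟩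
  Σ⟨ (λ j → if does (P? j) then 1 else 0) ⟩ (allFin m)     ≡⟨ Σ-allFin (λ j → if does (P? j) then 1 else 0) ⟩
  ∑[ j < m ] (if does (P? j) then 1 else 0)                ≡⟨ sum-cong-≗ pointwise ⟩
  ∑[ j < m ] ⟦ Vec.lookup (∁ S) j ⟧                        ≡⟨ ∣p∣≡∑ (∁ S) ⟨
  ∣ ∁ S ∣                                                  ≡⟨ ∣∁p∣≡n∸∣p∣ S ⟩
  m ∸ ∣ S ∣                                                ∎
  where
  open ≡-Reasoning
  P? = λ j → ¬? (j ∈? S)
  pointwise : ∀ j → (if does (P? j) then 1 else 0) ≡ ⟦ Vec.lookup (∁ S) j ⟧
  pointwise j rewrite does-∈? j S | lookup-map j not S with Vec.lookup S j
  ... | true = refl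
  ... | false = refl

Σ-extensions-const : ∀ {m} (w : Subset m → ℕ) (S : Subset m) c →
  (∀ j → j ∉ S → w (S ∪ ⁅ j ⁆) ≡ c) → Σ⟨ w ⟩ (extensions S (allFin m)) ≡ (m ∸ ∣ S ∣) * c
Σ-extensions-const {m} w S c const = begin
  Σ⟨ w ⟩ (extensions S (allFin m))                         ≡⟨ Σ-map w (λ j → S ∪ ⁅ j ⁆) outside-S ⟩
  Σ⟨ (λ j → w (S ∪ ⁅ j ⁆)) ⟩ outside-S                     ≡⟨ Σ-const-on _ c (All.map (const _) (All.all-filter P? (allFin m))) ⟩
  length outside-S * c                                      ≡⟨ cong (_* c) (length-outside S) ⟩
  (m ∸ ∣ S ∣) * c                                           ∎
  where
  open ≡-Reasoning
  P? = λ j → ¬? (j ∈? S)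
  outside-S = filter P? (allFin m)

extension-within : ∀ {m} (U S : Subset m) → ∣ S ∣ < ∣ U ∣ → within U S ≤ Σ⟨ within U ⟩ (extensions S (allFin m))
extension-within U S ∣S∣<∣U∣ with S ⊆? U
... | no _ = z≤n
... | yes S⊆U = ≤-trans (≤-reflexive (sym (within-yes T⊆U))) (Σ-∈ (within U) T∈extensions)
  where
  1≤∣U─S∣ : 1 ≤ ∣ U ─ S ∣
  1≤∣U─S∣ = +-cancelʳ-≤ ∣ S ∣ 1 (∣ U ─ S ∣)
    (≤-trans ∣S∣<∣U∣ (≤-trans (∣p∣≤∣p∪q∣ U S) (≤-reflexive (∣p∪q∣≡∣p─q∣+∣q∣ U S))))
  j∈U─S = ∈-of-nonempty (U ─ S) 1≤∣U─S∣
  j = proj₁ j∈U─S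
  j∉S : j ∉ S
  j∉S = x∈p─q⇒x∉q U S (proj₂ j∈U─S)
  T⊆U : S ∪ ⁅ j ⁆ ⊆ U
  T⊆U x∈ with x∈p∪q⁻ S ⁅ j ⁆ x∈
  ... | inj₁ x∈S = S⊆U x∈S
  ... | inj₂ x∈⁅j⁆ rewrite x∈⁅y⁆⇒x≡y j x∈⁅j⁆ = p─q⊆p U S (proj₂ j∈U─S)
  T∈extensions : S ∪ ⁅ j ⁆ ∈ₗ extensions S (allFin _)
  T∈extensions = ∈-map⁺ (λ j → S ∪ ⁅ j ⁆) (∈-filter⁺ (λ j → ¬? (j ∈? S)) (∈-allFin j) j∉S)

Σ-B₀ : ∀ k m r .{{_ : NonZero r}} (w : Subset m → ℕ) →
  Σ⟨ w ⟩ (B₀ k m r) ≡ ((k ∸ 1) / r) * Σ⟨ w ⟩ (subsetsOfSize m (k ∸ 1))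
Σ-B₀ k m r w = begin
  Σ⟨ w ⟩ (concatMap (replicate q) 𝒯)       ≡⟨ Σ-concatMap w (replicate q) 𝒯 ⟩
  Σ⟨ (λ T → Σ⟨ w ⟩ (replicate q T)) ⟩ 𝒯     ≡⟨ Σ-cong (Σ-replicate w q) 𝒯 ⟩
  Σ⟨ (λ T → q * w T) ⟩ 𝒯                   ≡⟨ Σ-scale q w 𝒯 ⟩
  q * Σ⟨ w ⟩ 𝒯                             ∎
  where
  open ≡-Reasoning
  q = (k ∸ 1) / r
  𝒯 = subsetsOfSize m (k ∸ 1)

≤-from-balance : ∀ {a b c d} → c ≤ b → a + b ≡ c + d → a ≤ d
≤-from-balance {a} {b} {c} {d} c≤b a+b≡c+d = +-cancelʳ-≤ b a d (begin
  a + b   ≡⟨ a+b≡c+d ⟩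
  c + d   ≤⟨ +-monoˡ-≤ d c≤b ⟩
  b + d   ≡⟨ +-comm b d ⟩
  d + b   ∎)
  where open ≤-Reasoning

-- The arithmetic turning the two counts into N = n (s + 1) - α.
total-arith : ∀ n T α c q C s → n + α * c ≡ q * C → T + α * (suc c * suc s) ≡ α * s + q * (C * suc s) →
  T + α ≡ n * suc s
total-arith n T α c q C s blocks incidences = +-cancelʳ-≡ (α * s + α * c * suc s) (T + α) (n * suc s) (begin
  T + α + (α * s + α * c * suc s)        ≡⟨ e₁ T α s c ⟩
  T + α * (suc c * suc s)                ≡⟨ incidences ⟩
  α * s + q * (C * suc s)                ≡⟨ e₂ α s q C ⟩
  α * s + (q * C) * suc s                ≡⟨ cong (λ t → α * s + t * suc s) blocks ⟨
  α * s + (n + α * c) * suc s            ≡⟨ e₃ α s n c ⟩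
  n * suc s + (α * s + α * c * suc s)    ∎)
  where
  open ≡-Reasoning
  e₁ : ∀ T α s c → T + α + (α * s + α * c * suc s) ≡ T + α * (suc c * suc s)
  e₁ = solve-∀
  e₂ : ∀ α s q C → α * s + q * (C * suc s) ≡ α * s + (q * C) * suc s
  e₂ = solve-∀
  e₃ : ∀ α s n c → α * s + (n + α * c) * suc s ≡ n * suc s + (α * s + α * c * suc s)
  e₃ = solve-∀

module Construction (s m r : ℕ) .{{_ : NonZero r}} (r≤s : r ≤ s) where

  q : ℕ
  q = suc s / r

  1≤q : 1 ≤ q
  1≤q = m≥n⇒m/n>0 (m≤n⇒m≤1+n r≤s)

  𝓑 : List (Subset m) → List (Subset m)
  𝓑 = construction (suc (suc s)) m r

  Weights Apart : List (Subset m) → Set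
  Weights 𝒮 = All (λ S → ∣ S ∣ ≡ s) 𝒮
  Apart 𝒮 = AllPairs (λ S S′ → 4 ≤ hamming S S′) 𝒮

  crowded : ∀ {S S′ T : Subset m} → ∣ S ∣ ≡ s → ∣ S′ ∣ ≡ s → 4 ≤ hamming S S′ → ∣ T ∣ ≤ suc s → S ⊆ T → ¬ S′ ⊆ T
  crowded ∣S∣ ∣S′∣ far ∣T∣≤ S⊆T S′⊆T = 1+n≰n (≤-trans (apart ∣S∣ ∣S′∣ far S⊆T S′⊆T) ∣T∣≤)

  Survives : List (Subset m) → Set
  Survives 𝒮 = ∀ T → ∣ T ∣ ≡ suc s → All (λ S → ¬ S ⊆ T) 𝒮 → T ∈ₗ 𝓑 𝒮

  survives-B₀ : Survives []
  survives-B₀ T ∣T∣ [] = ∈-concat⁺′ (T∈copies q 1≤q) (∈-map⁺ (replicate q) T∈𝒯)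
    where
    T∈copies : ∀ n → 1 ≤ n → T ∈ₗ replicate n T
    T∈copies (suc n) _ = here refl
    T∈𝒯 : T ∈ₗ subsetsOfSize m (suc s)
    T∈𝒯 = ∈-filter⁺ (λ T → ∣ T ∣ ≟ℕ suc s) (allSubsets-complete T) ∣T∣

  extensions-present : ∀ {S 𝒮} → ∣ S ∣ ≡ s → Weights 𝒮 → All (λ S′ → 4 ≤ hamming S S′) 𝒮 →
    Survives 𝒮 → All (_∈ₗ 𝓑 𝒮) (extensions S (allFin m))
  extensions-present {S} {𝒮} ∣S∣ ws far survive =
    All.map⁺ (All.map present (All.all-filter (λ j → ¬? (j ∈? S)) (allFin m)))
    where
    present : ∀ {j} → j ∉ S → S ∪ ⁅ j ⁆ ∈ₗ 𝓑 𝒮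
    present {j} j∉S = survive (S ∪ ⁅ j ⁆) ∣S∪j∣
      (All.zipWith (λ (∣S′∣ , far′) → crowded ∣S∣ ∣S′∣ far′ (≤-reflexive ∣S∪j∣) (p⊆p∪q {p = S} ⁅ j ⁆)) (ws , far))
      where
      ∣S∪j∣ : ∣ S ∪ ⁅ j ⁆ ∣ ≡ suc s
      ∣S∪j∣ = trans (∣p∪⁅x⁆∣≡1+∣p∣ S j∉S) (cong suc ∣S∣)

  strip-𝓑 : ∀ {S 𝒮} → ∣ S ∣ ≡ s → Weights 𝒮 → All (λ S′ → 4 ≤ hamming S S′) 𝒮 → Survives 𝒮 →
    strip S (𝓑 𝒮) (allFin m) ++ extensions S (allFin m) ↭ 𝓑 𝒮
  strip-𝓑 {S} {𝒮} ∣S∣ ws far survive =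
    strip-↭ S (𝓑 𝒮) (allFin m) (allFin⁺ m) (extensions-present ∣S∣ ws far survive)

  -- Induction on the codewords: a set containing no codeword is not an
  -- extension of the codeword just added, so it is not stripped.
  survives : ∀ 𝒮 → Weights 𝒮 → Apart 𝒮 → Survives 𝒮
  survives [] _ _ = survives-B₀
  survives (S ∷ 𝒮) (∣S∣ ∷ ws) (far ∷ ds) T ∣T∣ (S⊈T ∷ none)
    with ∈-++⁻ (strip S (𝓑 𝒮) (allFin m))
                (∈-resp-↭ (↭-sym (strip-𝓑 ∣S∣ ws far (survives 𝒮 ws ds))) (survives 𝒮 ws ds T ∣T∣ none))
  ... | inj₁ T∈stripped = there T∈stripped
  ... | inj₂ T∈extensions = ⊥-elim (S⊈T (extension-⊇ (allFin m) T∈extensions))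

  balance : ∀ 𝒮 → Weights 𝒮 → Apart 𝒮 →
    𝓑 𝒮 ++ concatMap (λ S → extensions S (allFin m)) 𝒮 ↭ 𝒮 ++ B₀ (suc (suc s)) m r
  balance [] _ _ = ↭-reflexive (List.++-identityʳ _)
  balance (S ∷ 𝒮) (∣S∣ ∷ ws) (far ∷ ds) = begin
    S ∷ R ++ (E ++ Es)     ↭⟨ ↭-prep S (↭-++-assoc R E Es) ⟨
    S ∷ (R ++ E) ++ Es     ↭⟨ ↭-prep S (++⁺ʳ Es (strip-𝓑 ∣S∣ ws far (survives 𝒮 ws ds))) ⟩
    S ∷ 𝓑 𝒮 ++ Es          ↭⟨ ↭-prep S (balance 𝒮 ws ds) ⟩
    S ∷ 𝒮 ++ B₀ (suc (suc s)) m r ∎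
    where
    open PermutationReasoning
    R = strip S (𝓑 𝒮) (allFin m)
    E = extensions S (allFin m)
    Es = concatMap (λ S → extensions S (allFin m)) 𝒮

  weight-balance : ∀ 𝒮 → Weights 𝒮 → Apart 𝒮 → ∀ (w : Subset m → ℕ) →
    Σ⟨ w ⟩ (𝓑 𝒮) + Σ⟨ (λ S → Σ⟨ w ⟩ (extensions S (allFin m))) ⟩ 𝒮 ≡ Σ⟨ w ⟩ 𝒮 + q * Σ⟨ w ⟩ (subsetsOfSize m (suc s))
  weight-balance 𝒮 ws ds w = begin
    Σ⟨ w ⟩ (𝓑 𝒮) + Σ⟨ (λ S → Σ⟨ w ⟩ (extensions S (allFin m))) ⟩ 𝒮
      ≡⟨ cong (Σ⟨ w ⟩ (𝓑 𝒮) +_) (Σ-concatMap w (λ S → extensions S (allFin m)) 𝒮) ⟨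
    Σ⟨ w ⟩ (𝓑 𝒮) + Σ⟨ w ⟩ Es      ≡⟨ Σ-++ w (𝓑 𝒮) Es ⟨
    Σ⟨ w ⟩ (𝓑 𝒮 ++ Es)            ≡⟨ Σ-↭ w (balance 𝒮 ws ds) ⟩
    Σ⟨ w ⟩ (𝒮 ++ B₀ (suc (suc s)) m r)  ≡⟨ Σ-++ w 𝒮 _ ⟩
    Σ⟨ w ⟩ 𝒮 + Σ⟨ w ⟩ (B₀ (suc (suc s)) m r)  ≡⟨ cong (Σ⟨ w ⟩ 𝒮 +_) (Σ-B₀ (suc (suc s)) m r w) ⟩
    Σ⟨ w ⟩ 𝒮 + q * Σ⟨ w ⟩ (subsetsOfSize m (suc s)) ∎
    where
    open ≡-Reasoning
    Es = concatMap (λ S → extensions S (allFin m)) 𝒮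

  -- A set U of size at most s + 1 contains at most one codeword, and only if
  -- |U| ≥ s ≥ r.
  codewords-within : ∀ 𝒮 → Weights 𝒮 → Apart 𝒮 → ∀ U → ∣ U ∣ ≤ suc s → r * Σ⟨ within U ⟩ 𝒮 ≤ ∣ U ∣
  codewords-within [] _ _ U _ = ≤-trans (≤-reflexive (*-zeroʳ r)) z≤n
  codewords-within (S ∷ 𝒮) (∣S∣ ∷ ws) (far ∷ ds) U ∣U∣≤ with S ⊆? U
  ... | no _ = codewords-within 𝒮 ws ds U ∣U∣≤
  ... | yes S⊆U = begin
    r * (1 + Σ⟨ within U ⟩ 𝒮)   ≡⟨ cong (λ t → r * (1 + t)) no-other ⟩
    r * 1                        ≡⟨ *-identityʳ r ⟩
    r                            ≤⟨ r≤s ⟩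
    s                            ≡⟨ ∣S∣ ⟨
    ∣ S ∣                        ≤⟨ p⊆q⇒∣p∣≤∣q∣ S⊆U ⟩
    ∣ U ∣                        ∎
    where
    open ≤-Reasoning
    no-other : Σ⟨ within U ⟩ 𝒮 ≡ 0
    no-other = trans (Σ-const-on (within U) 0
                 (All.zipWith (λ (∣S′∣ , far′) → within-no (crowded ∣S∣ ∣S′∣ far′ ∣U∣≤ S⊆U)) (ws , far)))
                 (*-zeroʳ (length 𝒮))

  within-balance : ∀ 𝒮 → Weights 𝒮 → Apart 𝒮 → ∀ U →
    Σ⟨ within U ⟩ (𝓑 𝒮) + Σ⟨ (λ S → Σ⟨ within U ⟩ (extensions S (allFin m))) ⟩ 𝒮 ≡
    Σ⟨ within U ⟩ 𝒮 + q * (∣ U ∣ C suc s)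
  within-balance 𝒮 ws ds U = trans (weight-balance 𝒮 ws ds (within U))
    (cong (λ t → Σ⟨ within U ⟩ 𝒮 + q * t) (subsets-inside m U (suc s)))

  -- Blocks of the construction inside a set U of size at most s + 1, counted
  -- r times, number at most |U|: for |U| = s + 1 there are at most q of them
  -- (each codeword inside U is compensated by an extension inside U), and for
  -- |U| ≤ s at most the codewords inside U.
  blocks-within : ∀ 𝒮 → Weights 𝒮 → Apart 𝒮 → ∀ U → ∣ U ∣ ≤ suc s → r * Σ⟨ within U ⟩ (𝓑 𝒮) ≤ ∣ U ∣
  blocks-within 𝒮 ws ds U ∣U∣≤ with m≤n⇒m<n∨m≡n ∣U∣≤
  ... | inj₂ ∣U∣≡ = begin
    r * Σ⟨ within U ⟩ (𝓑 𝒮)   ≤⟨ *-monoʳ-≤ r (≤-from-balance (Σ-mono _ _ (All.map extension ws)) balance-U) ⟩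
    r * (q * 1)                ≡⟨ cong (r *_) (*-identityʳ q) ⟩
    r * q                      ≡⟨ *-comm r q ⟩
    q * r                      ≤⟨ m/n*n≤m (suc s) r ⟩
    suc s                      ≡⟨ ∣U∣≡ ⟨
    ∣ U ∣                      ∎
    where
    open ≤-Reasoning
    extension : ∀ {S} → ∣ S ∣ ≡ s → within U S ≤ Σ⟨ within U ⟩ (extensions S (allFin m))
    extension {S} ∣S∣ = extension-within U S (subst₂ _<_ (sym ∣S∣) (sym ∣U∣≡) ≤-refl)
    balance-U : Σ⟨ within U ⟩ (𝓑 𝒮) + Σ⟨ (λ S → Σ⟨ within U ⟩ (extensions S (allFin m))) ⟩ 𝒮 ≡
                Σ⟨ within U ⟩ 𝒮 + q * 1
    balance-U = trans (within-balance 𝒮 ws ds U)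
      (cong (λ t → Σ⟨ within U ⟩ 𝒮 + q * t) (trans (cong (_C suc s) ∣U∣≡) (nCn≡1 (suc s))))
  ... | inj₁ ∣U∣< = begin
    r * Σ⟨ within U ⟩ (𝓑 𝒮)           ≤⟨ *-monoʳ-≤ r (≤-from-balance z≤n balance-U) ⟩
    r * (Σ⟨ within U ⟩ 𝒮 + q * 0)     ≡⟨ cong (λ t → r * t) (trans (cong (Σ⟨ within U ⟩ 𝒮 +_) (*-zeroʳ q)) (+-identityʳ _)) ⟩
    r * Σ⟨ within U ⟩ 𝒮               ≤⟨ codewords-within 𝒮 ws ds U ∣U∣≤ ⟩
    ∣ U ∣                              ∎
    where
    open ≤-Reasoning
    balance-U : Σ⟨ within U ⟩ (𝓑 𝒮) + Σ⟨ (λ S → Σ⟨ within U ⟩ (extensions S (allFin m))) ⟩ 𝒮 ≡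
                Σ⟨ within U ⟩ 𝒮 + q * 0
    balance-U = trans (within-balance 𝒮 ws ds U) (cong (λ t → Σ⟨ within U ⟩ 𝒮 + q * t) (k>n⇒nCk≡0 ∣U∣<))

  request-hall : ∀ 𝒮 → Weights 𝒮 → Apart 𝒮 → ∀ B → B ↭ 𝓑 𝒮 →
    (req : Vec (Fin (length B)) (suc (suc s))) → (∀ i → mult i req ≤ r) →
    HallCondition (List.lookup B) (Vec.toList req)
  request-hall 𝒮 ws ds B B↭ req mult≤r X Y req↭XY with suc (suc s) ≤? ∣ N (List.lookup B) X ∣
  ... | yes k≤∣U∣ = ≤-trans (begin
    length X                 ≤⟨ m≤m+n (length X) (length Y) ⟩
    length X + length Y      ≡⟨ List.length-++ X ⟨
    length (X ++ Y)          ≡⟨ ↭-length req↭XY ⟨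
    length (Vec.toList req)  ≡⟨ length-toList req ⟩
    suc (suc s)              ∎) k≤∣U∣
    where open ≤-Reasoning
  ... | no ∣U∣≱k = begin
    length X                                  ≤⟨ occupancy r (λ i → does (σ i ⊆? U)) X X-within occ≤r ⟩
    r * ∑[ i < length B ] within U (σ i)      ≡⟨ cong (r *_) (trans (Σ-lookup (within U) B) (Σ-↭ (within U) B↭)) ⟩
    r * Σ⟨ within U ⟩ (𝓑 𝒮)                   ≤⟨ blocks-within 𝒮 ws ds U (≤-pred (≰⇒> ∣U∣≱k)) ⟩
    ∣ U ∣                                     ∎
    where
    open ≤-Reasoning
    σ = List.lookup B
    U = N σ X
    X-within : All (λ i → does (σ i ⊆? U) ≡ true) X
    X-within = All.tabulate (λ {i} i∈X → dec-true (σ i ⊆? U) (∈-N σ i∈X))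
    occ≤r : ∀ i → occ i X ≤ r
    occ≤r i = begin
      occ i X                  ≤⟨ m≤m+n (occ i X) (occ i Y) ⟩
      occ i X + occ i Y        ≡⟨ Σ-++ (δ i) X Y ⟨
      occ i (X ++ Y)           ≡⟨ Σ-↭ (δ i) req↭XY ⟨
      occ i (Vec.toList req)   ≡⟨ mult≡occ i req ⟨
      mult i req               ≤⟨ mult≤r i ⟩
      r                        ∎

  -- With c = m - k + 1, every codeword has c + 1 extensions.
  module _ (k≤m : suc (suc s) ≤ m) where

    c : ℕ
    c = m ∸ suc (suc s) + 1

    m∸s≡1+c : m ∸ s ≡ suc c
    m∸s≡1+c = trans (pred-∸ (≤-trans (n≤1+n _) k≤m)) (cong suc (trans (pred-∸ k≤m) (+-comm 1 _)))
      where
      pred-∸ : ∀ {a b} → suc a ≤ b → b ∸ a ≡ suc (b ∸ suc a)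
      pred-∸ {zero} {suc b} _ = refl
      pred-∸ {suc a} {suc b} (s≤s a<b) = pred-∸ a<b

    Σ-extensions : ∀ (w : Subset m → ℕ) d → (∀ S j → ∣ S ∣ ≡ s → j ∉ S → w (S ∪ ⁅ j ⁆) ≡ d) →
      ∀ 𝒮 → Weights 𝒮 → Σ⟨ (λ S → Σ⟨ w ⟩ (extensions S (allFin m))) ⟩ 𝒮 ≡ length 𝒮 * (suc c * d)
    Σ-extensions w d fixed 𝒮 ws = Σ-const-on _ (suc c * d) (All.map each ws)
      where
      each : ∀ {S} → ∣ S ∣ ≡ s → Σ⟨ w ⟩ (extensions S (allFin m)) ≡ suc c * d
      each {S} ∣S∣ = trans (Σ-extensions-const w S d (λ j → fixed S j ∣S∣))
                           (trans (cong (λ t → (m ∸ t) * d) ∣S∣) (cong (_* d) m∸s≡1+c))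

    length-balance : ∀ 𝒮 → Weights 𝒮 → Apart 𝒮 → length (𝓑 𝒮) + length 𝒮 * c ≡ q * (m C suc s)
    length-balance 𝒮 ws ds = +-cancelˡ-≡ α _ _ (begin
      α + (length (𝓑 𝒮) + α * c)                         ≡⟨ +-left-comm α (length (𝓑 𝒮)) (α * c) ⟩
      length (𝓑 𝒮) + (α + α * c)                         ≡⟨ cong (length (𝓑 𝒮) +_) (sym (*-suc α c)) ⟩
      length (𝓑 𝒮) + α * suc c                           ≡⟨ cong₂ _+_ (Σ-one (𝓑 𝒮)) (cong (α *_) (*-identityʳ (suc c))) ⟨
      Σ⟨ one ⟩ (𝓑 𝒮) + α * (suc c * 1)                   ≡⟨ cong (Σ⟨ one ⟩ (𝓑 𝒮) +_) (Σ-extensions one 1 (λ _ _ _ _ → refl) 𝒮 ws) ⟨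
      Σ⟨ one ⟩ (𝓑 𝒮) + Σ⟨ (λ S → Σ⟨ one ⟩ (extensions S (allFin m))) ⟩ 𝒮
                                                           ≡⟨ weight-balance 𝒮 ws ds one ⟩
      Σ⟨ one ⟩ 𝒮 + q * Σ⟨ one ⟩ (subsetsOfSize m (suc s)) ≡⟨ cong₂ (λ a b → a + q * b) (Σ-one 𝒮) (trans (Σ-one (subsetsOfSize m (suc s))) (length-subsetsOfSize m (suc s))) ⟩
      α + q * (m C suc s)                                 ∎)
      where
      open ≡-Reasoning
      α = length 𝒮
      one : Subset m → ℕ
      one _ = 1

    size-balance : ∀ 𝒮 → Weights 𝒮 → Apart 𝒮 → Σ⟨ ∣_∣ ⟩ (𝓑 𝒮) + length 𝒮 ≡ length (𝓑 𝒮) * suc s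
    size-balance 𝒮 ws ds = total-arith (length (𝓑 𝒮)) (Σ⟨ ∣_∣ ⟩ (𝓑 𝒮)) (length 𝒮) c q (m C suc s) s
      (length-balance 𝒮 ws ds)
      (begin
        Σ⟨ ∣_∣ ⟩ (𝓑 𝒮) + length 𝒮 * (suc c * suc s)
          ≡⟨ cong (Σ⟨ ∣_∣ ⟩ (𝓑 𝒮) +_) (Σ-extensions ∣_∣ (suc s) (λ S j ∣S∣ j∉S → trans (∣p∪⁅x⁆∣≡1+∣p∣ S j∉S) (cong suc ∣S∣)) 𝒮 ws) ⟨
        Σ⟨ ∣_∣ ⟩ (𝓑 𝒮) + Σ⟨ (λ S → Σ⟨ ∣_∣ ⟩ (extensions S (allFin m))) ⟩ 𝒮
          ≡⟨ weight-balance 𝒮 ws ds ∣_∣ ⟩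
        Σ⟨ ∣_∣ ⟩ 𝒮 + q * Σ⟨ ∣_∣ ⟩ (subsetsOfSize m (suc s))
          ≡⟨ cong₂ (λ a b → a + q * b) (Σ-const-on ∣_∣ s ws) (Σ-size-subsetsOfSize m (suc s)) ⟩
        length 𝒮 * s + q * ((m C suc s) * suc s) ∎)
      where open ≡-Reasoning

    length-formula : ∀ 𝒮 → Weights 𝒮 → Apart 𝒮 → ∀ B → B ↭ 𝓑 𝒮 →
      length B ≡ q * (m C suc s) ∸ length 𝒮 * c
    length-formula 𝒮 ws ds B B↭𝓑 = begin
      length B                                   ≡⟨ m+n∸n≡m (length B) αc ⟨
      length B + αc ∸ αc                         ≡⟨ cong (λ t → t + αc ∸ αc) (↭-length B↭𝓑) ⟩
      length (𝓑 𝒮) + αc ∸ αc                     ≡⟨ cong (_∸ αc) (length-balance 𝒮 ws ds) ⟩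
      q * (m C suc s) ∸ αc                       ∎
      where
      open ≡-Reasoning
      αc = length 𝒮 * c

    total-formula : ∀ 𝒮 → Weights 𝒮 → Apart 𝒮 → ∀ B → B ↭ 𝓑 𝒮 →
      total (incidence B) ≡ length B * suc s ∸ length 𝒮
    total-formula 𝒮 ws ds B B↭𝓑 = begin
      total (incidence B)               ≡⟨ total-incidence B ⟩
      Σ⟨ ∣_∣ ⟩ B                         ≡⟨ Σ-↭ ∣_∣ B↭𝓑 ⟩
      Σ⟨ ∣_∣ ⟩ (𝓑 𝒮)                     ≡⟨ m+n∸n≡m _ α ⟨
      Σ⟨ ∣_∣ ⟩ (𝓑 𝒮) + α ∸ α             ≡⟨ cong (_∸ α) (size-balance 𝒮 ws ds) ⟩
      length (𝓑 𝒮) * suc s ∸ α          ≡⟨ cong (λ t → t * suc s ∸ α) (↭-length B↭𝓑) ⟨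
      length B * suc s ∸ α              ∎
      where
      open ≡-Reasoning
      α = length 𝒮

code-as-lists : ∀ {m d w} 𝒮 → IsCWCode m d w 𝒮 →
  All (λ S → ∣ S ∣ ≡ w) 𝒮 × AllPairs (λ S S′ → d ≤ hamming S S′) 𝒮
code-as-lists [] _ = [] , []
code-as-lists {d = d} (S ∷ 𝒮) (weight , distance)
  with code-as-lists 𝒮 ((λ i → weight (suc i)) , (λ i j i≢j → distance (suc i) (suc j) (i≢j ∘ suc-injective)))
... | ws , ds = weight zero ∷ ws , All.tabulate far ∷ ds
  where
  far : ∀ {S′} → S′ ∈ₗ 𝒮 → d ≤ hamming S S′
  far S′∈ = subst (λ S′ → d ≤ hamming S S′) (sym (lookup-index S′∈)) (distance zero (suc (index S′∈)) λ ())

theorem10 : (k m r : ℕ) → .{{_ : NonZero r}} → 1 ≤ k → 1 ≤ m → r ≤ k ∸ 2 → k ≤ m →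
    (𝒮 : List (Subset m)) → IsCWCode m 4 (k ∸ 2) 𝒮 →
    (B : List (Subset m)) → B ↭ construction k m r 𝒮 →
    IsMCBC (length B) (total (incidence B)) k m r (incidence B) ×
    length B ≡ ((k ∸ 1) / r) * (m C (k ∸ 1)) ∸ length 𝒮 * (m ∸ k + 1) ×
    total (incidence B) ≡ length B * (k ∸ 1) ∸ length 𝒮
-- For k ≤ 1 the hypothesis r ≤ k - 2 = 0 contradicts r ≠ 0.
theorem10 zero m r _ _ r≤0 = ⊥-elim (<⇒≱ (>-nonZero⁻¹ r) r≤0)
theorem10 (suc zero) m r _ _ r≤0 = ⊥-elim (<⇒≱ (>-nonZero⁻¹ r) r≤0)
theorem10 (suc (suc s)) m r _ _ r≤s k≤m 𝒮 code B B↭𝓑 =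
  (refl , λ req mult≤r → retrieval B req (request-hall 𝒮 ws ds B B↭𝓑 req mult≤r)) ,
  length-formula k≤m 𝒮 ws ds B B↭𝓑 ,
  total-formula k≤m 𝒮 ws ds B B↭𝓑
  where
  open Construction s m r r≤s
  ws = proj₁ (code-as-lists 𝒮 code)
  ds = proj₂ (code-as-lists 𝒮 code)
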